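{- Let $K$ be a number field with $\sqrt{2}\in K$. Then the set of points $M\in K^2$ such that the Euclidean distances from $M$ to each of the four vertices $(0,0)$, $(0,1)$, $(1,0)$, $(1,1)$ of the unit square all lie in $K$ is infinite.
   Context: A distance $|MP|$ lies in $K$ means $\sqrt{(m_1-p_1)^2+(m_2-p_2)^2}\in K$ for $M=(m_1,m_2)$, $P=(p_1,p_2)$. -}

module Defs where

open import Level using (Level; _⊔_)
open import Data.Nat using (ℕ; zero; suc)
open import Data.Fin using (Fin)
import Data.Fin as Fin
open import Data.Product using (Σ; ∃; _×_; _,_)
open import Relation.Nullary using (¬_)
open import Relation.Binary.PropositionalEquality using (_≡_)
open import Algebra.Bundles using (CommutativeRing)
open import Algebra.Morphism.Structures using (IsRingMonomorphism)
import Data.Rational as ℚ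
open ℚ using (ℚ)

module _ {c ℓ : Level} (R : CommutativeRing c ℓ) where
  open CommutativeRing R

  ∑ : ∀ {n} → (Fin n → Carrier) → Carrier
  ∑ {zero}  f = 0#
  ∑ {suc n} f = f Fin.zero + ∑ (λ i → f (Fin.suc i))

  record IsField : Set (c ⊔ ℓ) where
    field
      0≉1     : ¬ (0# ≈ 1#)
      inverse : ∀ x → ¬ (x ≈ 0#) → ∃ λ y → (x * y) ≈ 1#

-- A number field: a field K together with (the) embedding ℚ ↪ K (so K has
-- characteristic 0 and is a ℚ-algebra) such that K is finite-dimensional
-- over ℚ, i.e. spanned over ℚ by finitely many elements b₀ … b_{d-1}.
record NumberField (c ℓ : Level) : Set (Level.suc (c ⊔ ℓ)) where
  field
    fieldRing : CommutativeRing c ℓ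
  open CommutativeRing fieldRing
  field
    isField : IsField fieldRing
    ι       : ℚ → Carrier
    ι-mono  : IsRingMonomorphism ℚ.+-*-rawRing rawRing ι
    dim     : ℕ
    basis   : Fin dim → Carrier
    spans   : ∀ x → ∃ λ (a : Fin dim → ℚ) → x ≈ ∑ fieldRing (λ i → ι (a i) * basis i)

module _ {c ℓ : Level} (K : NumberField c ℓ) where
  open NumberField K
  open CommutativeRing fieldRing

  SqrtIn : Carrier → Set (c ⊔ ℓ)
  SqrtIn x = ∃ λ y → (y * y) ≈ x

  Point : Set c
  Point = Carrier × Carrier

  _≈ᵖ_ : Point → Point → Set ℓ
  (m₁ , m₂) ≈ᵖ (p₁ , p₂) = (m₁ ≈ p₁) × (m₂ ≈ p₂)

  DistIn : Point → Point → Set (c ⊔ ℓ)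
  DistIn (m₁ , m₂) (p₁ , p₂) =
    SqrtIn (((m₁ - p₁) * (m₁ - p₁)) + ((m₂ - p₂) * (m₂ - p₂)))

  GoodPoint : Point → Set (c ⊔ ℓ)
  GoodPoint M = DistIn M (0# , 0#) × DistIn M (0# , 1#)
              × DistIn M (1# , 0#) × DistIn M (1# , 1#)

  HasSqrt2 : Set (c ⊔ ℓ)
  HasSqrt2 = SqrtIn (1# + 1#)

  InfiniteSet : (Point → Set (c ⊔ ℓ)) → Set (c ⊔ ℓ)
  InfiniteSet P = ∃ λ (f : ℕ → Point) →
    (∀ n → P (f n)) × (∀ m n → f m ≈ᵖ f n → m ≡ n)

-- We look for such points on the diagonal, M = (a , a).  Its distances to
-- (0,0) and (1,1) are √2·a and √2·(a-1), which lie in K as soon as √2 does;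
-- its distances to (0,1) and (1,0) both equal √(a² + (a-1)²).  So it suffices
-- to find infinitely many a with a² + (a-1)² a square in K, and we take
-- a = w + 1 for the near-isosceles Pythagorean triples (w, w+1, z):
-- (0,1,1), (3,4,5), (20,21,29), … generated by the Pell-type recursion
-- (w , z) ↦ (3w + 2z + 1 , 4w + 3z + 2).

module Submission where

open import Defs
open import Level using (Level)
open import Data.Nat as ℕ using (ℕ; zero; suc; s≤s; _≤′_; ≤′-refl; ≤′-step)
import Data.Nat.Properties as ℕP
open import Data.Nat.Tactic.RingSolver using (solve-∀)
open import Data.Product using (_,_)
open import Relation.Binary.PropositionalEquality as ≡ using (_≡_)
open import Relation.Binary.Structures using (IsStrictPartialOrder)
open import Relation.Binary.Definitions using (tri<; tri≈; tri>)
open import Relation.Nullary using (contradiction)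
import Data.Rational as ℚ
import Data.Rational.Properties as ℚP
open import Algebra.Bundles using (CommutativeRing)
open import Algebra.Morphism.Structures using (IsRingMonomorphism)
import Algebra.Properties.Semiring.Mult as SemiringMult

module _ {a ℓ r} {A : Set a} {_≈_ : A → A → Set ℓ} {_<_ : A → A → Set r}
         (isSPO : IsStrictPartialOrder _≈_ _<_)
         (f : ℕ → A) (step : ∀ n → f n < f (suc n)) where
  open IsStrictPartialOrder isSPO

  stepwise⇒monotone : ∀ {m n} → suc m ≤′ n → f m < f n
  stepwise⇒monotone ≤′-refl         = step _
  stepwise⇒monotone (≤′-step m<′n) = trans (stepwise⇒monotone m<′n) (step _)

  stepwise⇒injective : ∀ m n → f m ≈ f n → m ≡ n
  stepwise⇒injective m n fm≈fn with ℕP.<-cmp m n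
  ... | tri< m<n _ _ = contradiction (stepwise⇒monotone (ℕP.<⇒<′ m<n)) (irrefl fm≈fn)
  ... | tri≈ _ m≡n _ = m≡n
  ... | tri> _ _ n<m = contradiction (stepwise⇒monotone (ℕP.<⇒<′ n<m)) (irrefl (Eq.sym fm≈fn))

record NearIsoscelesTriple : Set where
  constructor triple
  field
    leg hypotenuse : ℕ
    pythagoras     : suc leg ℕ.* suc leg ℕ.+ leg ℕ.* leg ≡ hypotenuse ℕ.* hypotenuse
open NearIsoscelesTriple

-- The polynomial identity behind the recursion (w , z) ↦ (w′ , z′):
-- (w′+1)² + w′² - z′² = (w+1)² + w² - z², written without subtraction.
private
  recursion-identity : ∀ w z →
    let w′ = suc (3 ℕ.* w ℕ.+ 2 ℕ.* z)
        z′ = 4 ℕ.* w ℕ.+ 3 ℕ.* z ℕ.+ 2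
    in (suc w′ ℕ.* suc w′ ℕ.+ w′ ℕ.* w′) ℕ.+ z ℕ.* z
       ≡ z′ ℕ.* z′ ℕ.+ (suc w ℕ.* suc w ℕ.+ w ℕ.* w)
  recursion-identity = solve-∀

next : NearIsoscelesTriple → NearIsoscelesTriple
next (triple w z pyth) = triple w′ z′ (ℕP.+-cancelʳ-≡ (z ℕ.* z) _ _ (begin
    (suc w′ ℕ.* suc w′ ℕ.+ w′ ℕ.* w′) ℕ.+ z ℕ.* z  ≡⟨ recursion-identity w z ⟩
    z′ ℕ.* z′ ℕ.+ (suc w ℕ.* suc w ℕ.+ w ℕ.* w)    ≡⟨ ≡.cong (z′ ℕ.* z′ ℕ.+_) pyth ⟩
    z′ ℕ.* z′ ℕ.+ z ℕ.* z                          ∎))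
  where
  open ≡.≡-Reasoning
  w′ = suc (3 ℕ.* w ℕ.+ 2 ℕ.* z)
  z′ = 4 ℕ.* w ℕ.+ 3 ℕ.* z ℕ.+ 2

triples : ℕ → NearIsoscelesTriple
triples zero    = triple 0 1 ≡.refl
triples (suc n) = next (triples n)

leg-increasing : ∀ n → leg (triples n) ℕ.< leg (triples (suc n))
leg-increasing n = s≤s (ℕP.≤-trans (ℕP.m≤m+n w (2 ℕ.* w)) (ℕP.m≤m+n (3 ℕ.* w) _))
  where w = leg (triples n)

-- Multiples of 1 in ℚ, i.e. the canonical map ℕ → ℚ, with its homomorphism
-- laws (ℚ's equality is propositional, so they are equations).
open SemiringMult (CommutativeRing.semiring ℚP.+-*-commutativeRing)
  using () renaming (_×_ to _×ℚ_; ×-homo-+ to ×ℚ-homo-+; ×1-homo-* to ×ℚ1-homo-*)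

multiples-of-1-increasing : ∀ n → n ×ℚ ℚ.1ℚ ℚ.< suc n ×ℚ ℚ.1ℚ
multiples-of-1-increasing n =
  ≡.subst (ℚ._< ℚ.1ℚ ℚ.+ q) (ℚP.+-identityˡ q) (ℚP.+-monoˡ-< q (ℚP.positive⁻¹ ℚ.1ℚ))
  where q = n ×ℚ ℚ.1ℚ

module InNumberField {c ℓ : Level} (K : NumberField c ℓ) where
  open NumberField K
  open CommutativeRing fieldRing
  open IsRingMonomorphism ι-mono using (injective; +-homo; *-homo; 1#-homo)
  open import Algebra.Properties.AbelianGroup +-abelianGroup using (ε⁻¹≈ε; xyx⁻¹≈y)
  open import Algebra.Properties.CommutativeSemigroup *-commutativeSemigroup using (interchange)
  open import Relation.Binary.Reasoning.Setoid setoid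

  ℕ→K : ℕ → Carrier
  ℕ→K n = ι (n ×ℚ ℚ.1ℚ)

  ℕ→K-suc : ∀ n → ℕ→K (suc n) ≈ 1# + ℕ→K n
  ℕ→K-suc n = trans (+-homo ℚ.1ℚ (n ×ℚ ℚ.1ℚ)) (+-congʳ 1#-homo)

  ℕ→K-+ : ∀ m n → ℕ→K (m ℕ.+ n) ≈ ℕ→K m + ℕ→K n
  ℕ→K-+ m n = trans (reflexive (≡.cong ι (×ℚ-homo-+ ℚ.1ℚ m n))) (+-homo _ _)

  ℕ→K-* : ∀ m n → ℕ→K (m ℕ.* n) ≈ ℕ→K m * ℕ→K n
  ℕ→K-* m n = trans (reflexive (≡.cong ι (×ℚ1-homo-* m n))) (*-homo _ _)

  -- K has characteristic 0, since ι is injective.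
  ℕ→K-injective : ∀ m n → ℕ→K m ≈ ℕ→K n → m ≡ n
  ℕ→K-injective m n e = stepwise⇒injective ℚP.<-isStrictPartialOrder
    (_×ℚ ℚ.1ℚ) multiples-of-1-increasing m n (injective e)

  sqrt-resp : ∀ {x y} → x ≈ y → SqrtIn K x → SqrtIn K y
  sqrt-resp x≈y (r , r²≈x) = r , trans r²≈x x≈y

  square-cong : ∀ {x y} → x ≈ y → x * x ≈ y * y
  square-cong x≈y = *-cong x≈y x≈y

  diagonal-length : HasSqrt2 K → ∀ a → SqrtIn K (a * a + a * a)
  diagonal-length (r , r²≈2) a = r * a , (begin
    (r * a) * (r * a)            ≈⟨ interchange r a r a ⟩
    (r * r) * (a * a)            ≈⟨ *-congʳ r²≈2 ⟩
    (1# + 1#) * (a * a)          ≈⟨ distribʳ (a * a) 1# 1# ⟩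
    1# * (a * a) + 1# * (a * a)  ≈⟨ +-cong (*-identityˡ _) (*-identityˡ _) ⟩
    a * a + a * a                ∎)

  diagonal-good : HasSqrt2 K → ∀ a → SqrtIn K (a * a + (a - 1#) * (a - 1#)) →
    GoodPoint K (a , a)
  diagonal-good √2 a h =
    sqrt-resp (sym (+-cong (square-cong a-0≈a) (square-cong a-0≈a))) (diagonal-length √2 a) ,
    sqrt-resp (sym (+-congʳ (square-cong a-0≈a))) h ,
    sqrt-resp (trans (+-comm _ _) (sym (+-congˡ (square-cong a-0≈a)))) h ,
    diagonal-length √2 (a - 1#)
    where
    a-0≈a : a - 0# ≈ a
    a-0≈a = trans (+-congˡ ε⁻¹≈ε) (+-identityʳ a)

  triple-sqrt : ∀ t → let a = ℕ→K (suc (leg t)) in SqrtIn K (a * a + (a - 1#) * (a - 1#))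
  triple-sqrt (triple w z pyth) = ℕ→K z , sym (begin
    a * a + (a - 1#) * (a - 1#)            ≈⟨ +-congˡ (square-cong a-1≈w) ⟩
    a * a + ℕ→K w * ℕ→K w                  ≈⟨ sym (+-cong (ℕ→K-* (suc w) (suc w)) (ℕ→K-* w w)) ⟩
    ℕ→K (suc w ℕ.* suc w) + ℕ→K (w ℕ.* w)  ≈⟨ sym (ℕ→K-+ (suc w ℕ.* suc w) (w ℕ.* w)) ⟩
    ℕ→K (suc w ℕ.* suc w ℕ.+ w ℕ.* w)      ≡⟨ ≡.cong ℕ→K pyth ⟩
    ℕ→K (z ℕ.* z)                          ≈⟨ ℕ→K-* z z ⟩
    ℕ→K z * ℕ→K z                          ∎)
    where
    a = ℕ→K (suc w)
    a-1≈w : a - 1# ≈ ℕ→K w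
    a-1≈w = trans (+-congʳ (ℕ→K-suc w)) (xyx⁻¹≈y 1# (ℕ→K w))

theorem2p2 : ∀ {c ℓ : Level} (K : NumberField c ℓ) →
    HasSqrt2 K → InfiniteSet K (GoodPoint K)
theorem2p2 K √2 = point , good , injective
  where
  open InNumberField K

  point : ℕ → Point K
  point n = let a = ℕ→K (suc (leg (triples n))) in a , a

  good : ∀ n → GoodPoint K (point n)
  good n = diagonal-good √2 _ (triple-sqrt (triples n))

  injective : ∀ m n → _≈ᵖ_ K (point m) (point n) → m ≡ n
  injective m n (a≈a′ , _) = stepwise⇒injective ℕP.<-isStrictPartialOrder
    (λ k → leg (triples k)) leg-increasing m n
    (ℕP.suc-injective (ℕ→K-injective _ _ a≈a′))
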